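{- Let $T$ be a finite tree all of whose vertices have odd degree. Let $Q=v_1\ldots v_n$ be a path in $T$ such that at most $\frac12(\deg_T v_n-1)$ of the neighbours of $v_n$ are leaves, and for every $i\in[n-1]$ fewer than $\frac12(\deg_T v_i-1)$ of the neighbours of $v_i$ are leaves. Then there exists $\xi_0\in\{ -1,1\}^{V(T)}$ such that, for the majority dynamics started from $\xi_0$, \begin{itemize} \item $\xi_{i+1}(v_i)=-1$ for every $i\in[n]$, and \item $\xi_t(v_i)=1$ for every $i\in[n]$ and every $t\le i$. \end{itemize}
   Context: Majority dynamics: for $t\ge1$ and every vertex $i$, $\xi_t(i)=\mathrm{sign}\sum_{j\in N_T(i)}\xi_{t-1}(j)$. -}

module Defs where

open import Data.Nat using (ℕ; zero; suc; _+_; _*_; _∸_; _≤_; _<_)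
open import Data.Nat.Properties using ()
open import Data.Bool using (Bool; true; false; if_then_else_)
open import Data.Fin using (Fin; toℕ; fromℕ) renaming (zero to fzero)
open import Data.List using (List; map; foldr; allFin; filter; length)
open import Data.Integer using (ℤ; +_; -_; sign)
import Data.Integer as ℤ
open import Data.Sign using (Sign) renaming (+ to plus; - to minus)
open import Data.Product using (Σ; ∃; _×_)
open import Relation.Binary.PropositionalEquality using (_≡_)
open import Relation.Nullary using (¬_)
open import Function.Definitions using (Injective)

record Graph (N : ℕ) : Set where
  field
    adj   : Fin N → Fin N → Bool
    sym   : ∀ u v → adj u v ≡ adj v u
    irrefl : ∀ u → adj u u ≡ false
open Graph public

module _ {N : ℕ} (G : Graph N) where

  Adj : Fin N → Fin N → Set
  Adj u v = adj G u v ≡ true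

  data Walk : Fin N → Fin N → Set where
    here : ∀ u → Walk u u
    step : ∀ {u v w} → Adj u v → Walk v w → Walk u w

  Connected : Set
  Connected = ∀ u w → Walk u w

  IsPath : {k : ℕ} → (Fin k → Fin N) → Set
  IsPath {k} c = Injective _≡_ _≡_ c
               × (∀ (i j : Fin k) → toℕ j ≡ suc (toℕ i) → Adj (c i) (c j))

  IsCycle : {k : ℕ} → (Fin (3 + k) → Fin N) → Set
  IsCycle {k} c = IsPath c × Adj (c (fromℕ (2 + k))) (c fzero)

  Acyclic : Set
  Acyclic = ∀ (k : ℕ) (c : Fin (3 + k) → Fin N) → ¬ IsCycle c

  IsTree : Set
  IsTree = Connected × Acyclic

  deg : Fin N → ℕ
  deg v = length (filter (λ j → Data.Bool._≟_ (adj G v j) true) (allFin N))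

  IsLeaf : Fin N → Set
  IsLeaf v = deg v ≡ 1

  leafNbrs : Fin N → ℕ
  leafNbrs v = length (filter (λ j → Data.Bool._≟_ (adj G v j) true)
                              (filter (λ j → Data.Nat._≟_ (deg j) 1) (allFin N)))

  Config : Set
  Config = Fin N → Sign

  spin : Sign → ℤ
  spin plus  = + 1
  spin minus = - (+ 1)

  sumℤ : List ℤ → ℤ
  sumℤ = foldr ℤ._+_ (+ 0)

  nbrSum : Config → Fin N → ℤ
  nbrSum ξ i = sumℤ (map (λ j → if adj G i j then spin (ξ j) else + 0) (allFin N))

  -- majority dynamics ξ_t(i) = sign ∑_{j∈N(i)} ξ_{t-1}(j)
  -- (Data.Integer.sign maps 0 to plus; ties never occur when all degrees are odd)
  dyn : Config → ℕ → Config
  dyn ξ₀ zero    = ξ₀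
  dyn ξ₀ (suc t) i = sign (nbrSum (dyn ξ₀ t) i)

Odd : ℕ → Set
Odd n = ∃ λ k → n ≡ suc (2 * k)

-- Write deg v_k = 2 h_k + 1.  In a tree every vertex off the path lies in a branch of
-- T − Q that hangs from the path by a single edge r — v_k, r being the root of the branch.
-- Start with +1 on the path.  A branch at v_k, k ≥ 1, carries the constant spin of its
-- root: −1 for h_k chosen non-leaf roots and +1 otherwise; a non-leaf root has degree
-- at least 3 but only one neighbour on the path, so such a branch never changes.  A branch
-- at v_0 gets +1 at its root and −1 elsewhere, so a non-leaf root flips to −1 at time 1.
-- Leaves copy their neighbour one step later.  The bounds on leaf neighbours leave at
-- least h_0 + 1 non-leaf roots at v_0 and h_k at v_k.  Hence up to time k vertex v_k has
-- at most h_k negative neighbours and stays +1 through time k + 1, while at time k + 1 it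
-- has h_k + 1 of them (the flipped roots at v_0, resp. the chosen roots and v_{k−1}).

module Submission where

open import Defs renaming (sym to adj-sym; irrefl to adj-irrefl)
open import Level using (Level; 0ℓ)
open import Data.Nat using (ℕ; zero; suc; _+_; _*_; _∸_; _≤_; _<_; z≤n; s≤s; s≤s⁻¹)
import Data.Nat.Properties as ℕ
import Data.Bool as Bool
open import Data.Bool using (true; false; if_then_else_)
open import Data.Fin using (Fin; zero; suc; toℕ; fromℕ; inject₁)
open import Data.Fin.Properties using (any?; _≟_; 0≢1+n; suc-injective; toℕ-injective; toℕ<n; toℕ-inject₁)
import Data.Fin.Subset as Subset
open import Data.Fin.Subset using (Subset; inside; outside; _∈_; _∉_)
open import Data.Fin.Subset.Properties using (_∈?_; drop-there; ∉⊥)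
import Data.Vec.Base as Vec
open import Data.Vec.Base using (_∷_; [])
open import Data.List using (List; []; _∷_; length; filter; tabulate; allFin)
import Data.List as List
open import Data.Integer using (_⊖_; sign)
import Data.Integer as ℤ
open import Data.Integer.Properties using (+-identityˡ; ⊖-≥; sign-⊖-<; distribʳ-⊖-+-pos; distribʳ-⊖-+-neg)
open import Data.Sign using (Sign) renaming (+ to plus; - to minus)
import Data.Sign.Properties as Sign
open import Data.Product using (Σ; ∃-syntax; _×_; _,_; proj₁; proj₂)
import Data.Sum as Sum
open import Data.Sum using (_⊎_; inj₁; inj₂; swap)
open import Data.Unit using (⊤; tt)
open import Data.Empty using (⊥-elim)
open import Function using (id; _∘_)
open import Function.Definitions using (Injective)
open import Relation.Nullary using (¬_; yes; no; does)
open import Relation.Nullary.Decidable using (_×-dec_; _⊎-dec_; dec-true; dec-false; decidable-stable)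
open import Relation.Unary using (Pred; Decidable; _⊆_; _∪_; _∩_; _≐_; ∁)
open import Relation.Unary.Properties using (_∪?_; _∩?_; ∁?; ∅?)
open import Relation.Binary using (Rel; DecidableEquality)
open import Relation.Binary.Construct.Closure.ReflexiveTransitive using (Star; ε; _◅_; _◅◅_; gmap; map; reverse)
open import Relation.Binary.PropositionalEquality using (_≡_; _≢_; refl; cong; cong₂; sym; trans; subst; subst₂)

private variable
  ℓ ℓ′ ℓ″ : Level
  n : ℕ
  A : Set
  R S : Rel A ℓ
  a b : A

-- Counting decidable subsets of Fin n

count : {P : Pred (Fin n) ℓ} → Decidable P → ℕ
count {n = zero}  P? = 0
count {n = suc n} P? = (if does (P? zero) then 1 else 0) + count (P? ∘ suc)

count-zero : {P : Pred (Fin n) ℓ} (P? : Decidable P) → (∀ i → ¬ P i) → count P? ≡ 0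
count-zero {n = zero}  P? _  = refl
count-zero {n = suc n} P? ¬P with P? zero
... | yes p = ⊥-elim (¬P zero p)
... | no _  = count-zero (P? ∘ suc) (¬P ∘ suc)

count-mono : {P : Pred (Fin n) ℓ} {Q : Pred (Fin n) ℓ′} (P? : Decidable P) (Q? : Decidable Q) →
             P ⊆ Q → count P? ≤ count Q?
count-mono {n = zero}  _  _  _ = z≤n
count-mono {n = suc n} P? Q? P⊆Q with P? zero | Q? zero
... | yes _ | yes _ = s≤s (count-mono (P? ∘ suc) (Q? ∘ suc) P⊆Q)
... | yes p | no ¬q = ⊥-elim (¬q (P⊆Q p))
... | no _  | yes _ = ℕ.m≤n⇒m≤1+n (count-mono (P? ∘ suc) (Q? ∘ suc) P⊆Q)
... | no _  | no _  = count-mono (P? ∘ suc) (Q? ∘ suc) P⊆Q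

count-≐ : {P : Pred (Fin n) ℓ} {Q : Pred (Fin n) ℓ′} (P? : Decidable P) (Q? : Decidable Q) →
          P ≐ Q → count P? ≡ count Q?
count-≐ P? Q? (P⊆Q , Q⊆P) = ℕ.≤-antisym (count-mono P? Q? P⊆Q) (count-mono Q? P? Q⊆P)

count-∪ : {Q : Pred (Fin n) ℓ} {R : Pred (Fin n) ℓ′} (Q? : Decidable Q) (R? : Decidable R) →
          count (Q? ∪? R?) ≤ count Q? + count R?
count-∪ {n = zero}  _  _  = z≤n
count-∪ {n = suc n} Q? R? with Q? zero | R? zero
... | yes _ | yes _ = s≤s (ℕ.≤-trans (count-∪ (Q? ∘ suc) (R? ∘ suc))
                                    (ℕ.+-monoʳ-≤ (count (Q? ∘ suc)) (ℕ.n≤1+n _)))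
... | yes _ | no _  = s≤s (count-∪ (Q? ∘ suc) (R? ∘ suc))
... | no _  | yes _ = ℕ.≤-trans (s≤s (count-∪ (Q? ∘ suc) (R? ∘ suc)))
                               (ℕ.≤-reflexive (sym (ℕ.+-suc (count (Q? ∘ suc)) (count (R? ∘ suc)))))
... | no _  | no _  = count-∪ (Q? ∘ suc) (R? ∘ suc)

count-⊆-∪ : {P : Pred (Fin n) ℓ} {Q : Pred (Fin n) ℓ′} {R : Pred (Fin n) ℓ″}
            (P? : Decidable P) (Q? : Decidable Q) (R? : Decidable R) →
            P ⊆ Q ∪ R → count P? ≤ count Q? + count R?
count-⊆-∪ P? Q? R? P⊆Q∪R = ℕ.≤-trans (count-mono P? (Q? ∪? R?) P⊆Q∪R) (count-∪ Q? R?)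

count-strict : {P : Pred (Fin n) ℓ} {Q : Pred (Fin n) ℓ′} (P? : Decidable P) (Q? : Decidable Q) →
               Q ⊆ P → ∀ {i} → P i → ¬ Q i → suc (count Q?) ≤ count P?
count-strict {n = suc n} P? Q? Q⊆P {zero} p ¬q with P? zero | Q? zero
... | no ¬p | _     = ⊥-elim (¬p p)
... | yes _ | yes q = ⊥-elim (¬q q)
... | yes _ | no _  = s≤s (count-mono (Q? ∘ suc) (P? ∘ suc) Q⊆P)
count-strict {n = suc n} P? Q? Q⊆P {suc i} p ¬q with P? zero | Q? zero
... | yes _ | yes _ = s≤s (count-strict (P? ∘ suc) (Q? ∘ suc) Q⊆P p ¬q)
... | yes _ | no _  = s≤s (count-mono (Q? ∘ suc) (P? ∘ suc) Q⊆P)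
... | no ¬p | yes q = ⊥-elim (¬p (Q⊆P q))
... | no _  | no _  = count-strict (P? ∘ suc) (Q? ∘ suc) Q⊆P p ¬q

count-pos : {P : Pred (Fin n) ℓ} (P? : Decidable P) → ∀ {i} → P i → 0 < count P?
count-pos {n = suc n} P? {zero} p with P? zero
... | yes _ = s≤s z≤n
... | no ¬p = ⊥-elim (¬p p)
count-pos {n = suc n} P? {suc i} p with P? zero
... | yes _ = s≤s z≤n
... | no _  = count-pos (P? ∘ suc) p

count≤1 : {P : Pred (Fin n) ℓ} (P? : Decidable P) → (∀ {i j} → P i → P j → i ≡ j) → count P? ≤ 1
count≤1 {n = zero}  _  _      = z≤n
count≤1 {n = suc n} P? unique with P? zero
... | yes p = s≤s (ℕ.≤-reflexive (count-zero (P? ∘ suc) λ _ pi → 0≢1+n (unique p pi)))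
... | no _  = count≤1 (P? ∘ suc) (λ pi pj → suc-injective (unique pi pj))

subset-of-size : {P : Pred (Fin n) ℓ} (P? : Decidable P) (q : ℕ) → q ≤ count P? →
                 ∃[ s ] ((∀ {i} → i ∈ s → P i) × count (_∈? s) ≡ q)
subset-of-size {n = n} P? zero _ =
  Subset.⊥ , (λ i∈∅ → ⊥-elim (∉⊥ i∈∅)) , count-zero (_∈? Subset.⊥ {n}) (λ _ → ∉⊥)
subset-of-size {n = suc n} P? (suc q) q≤ with P? zero
... | yes p = let s , s⊆P , size = subset-of-size (P? ∘ suc) q (s≤s⁻¹ q≤) in
  inside ∷ s , (λ { Vec.here → p ; (Vec.there i∈s) → s⊆P i∈s }) ,
  cong suc (trans (count-≐ (λ i → suc i ∈? inside ∷ s) (_∈? s) (drop-there , Vec.there)) size)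
... | no _  = let s , s⊆P , size = subset-of-size (P? ∘ suc) (suc q) q≤ in
  outside ∷ s , (λ { (Vec.there i∈s) → s⊆P i∈s }) ,
  trans (count-≐ (λ i → suc i ∈? outside ∷ s) (_∈? s) (drop-there , Vec.there)) size

length-filter-tabulate : {P : Pred A ℓ} (P? : Decidable P) (f : Fin n → A) →
                         length (filter P? (tabulate f)) ≡ count (P? ∘ f)
length-filter-tabulate {n = zero}  P? f = refl
length-filter-tabulate {n = suc n} P? f with P? (f zero)
... | yes _ = cong suc (length-filter-tabulate P? (f ∘ suc))
... | no _  = length-filter-tabulate P? (f ∘ suc)

length-filter-allFin : {P : Pred (Fin n) ℓ} (P? : Decidable P) → length (filter P? (allFin n)) ≡ count P?
length-filter-allFin P? = length-filter-tabulate P? id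

filter-filter : {P : Pred A ℓ} {Q : Pred A ℓ′} (P? : Decidable P) (Q? : Decidable Q) (xs : List A) →
                filter P? (filter Q? xs) ≡ filter (Q? ∩? P?) xs
filter-filter P? Q? [] = refl
filter-filter P? Q? (x ∷ xs) with Q? x
... | no _ = filter-filter P? Q? xs
... | yes _ with P? x
...   | yes _ = cong (x ∷_) (filter-filter P? Q? xs)
...   | no _  = filter-filter P? Q? xs

double : ∀ m → 2 * m ≡ m + m
double m = cong (m +_) (ℕ.+-identityʳ m)

double<+⇒< : ∀ {m p} → 2 * m < p + m → m < p
double<+⇒< {m} {p} h = ℕ.+-cancelʳ-< m m p (subst (_< p + m) (double m) h)

+<double⇒< : ∀ {m p} → p + m < 2 * m → p < m
+<double⇒< {m} {p} h = ℕ.+-cancelʳ-< m p m (subst (p + m <_) (double m) h)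

majority-bound : ∀ {d m c} → d ≤ m + c → 2 * c < d → d < 2 * m
majority-bound {d} {m} {c} d≤ 2c< =
  ℕ.≤-<-trans d≤ (subst (m + c <_) (sym (double m)) (ℕ.+-monoʳ-< m c<m))
  where c<m : c < m
        c<m = ℕ.+-cancelʳ-< c c m (ℕ.<-≤-trans (subst (_< d) (double c) 2c<) d≤)

odd⇒pos : ∀ {d} → Odd d → 0 < d
odd⇒pos (_ , refl) = s≤s z≤n

odd⇒≥3 : ∀ {d} → Odd d → d ≢ 1 → 3 ≤ d
odd⇒≥3 (zero  , refl) d≢1 = ⊥-elim (d≢1 refl)
odd⇒≥3 (suc k , refl) _   = s≤s (s≤s (ℕ.≤-trans (s≤s z≤n) (ℕ.m≤n+m _ k)))

odd-split : ∀ {h x} → suc (2 * h) ≤ x + h → suc h ≤ x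
odd-split {h} {x} le = ℕ.+-cancelʳ-≤ h (suc h) x (subst (_≤ x + h) (cong suc (double h)) le)

odd<double : ∀ {h m} → suc h ≤ m → suc (2 * h) < 2 * m
odd<double {h} h< = ℕ.≤-trans (ℕ.≤-reflexive (sym (ℕ.*-suc 2 h))) (ℕ.*-monoʳ-≤ 2 h<)

-- Walks

steps : Star R a b → ℕ
steps ε       = 0
steps (_ ◅ w) = suc (steps w)

vertex : {a b : A} (w : Star R a b) → Fin (suc (steps w)) → A
vertex {a = a} ε       _       = a
vertex {a = a} (_ ◅ w) zero    = a
vertex         (_ ◅ w) (suc i) = vertex w i

vertex-last : (w : Star R a b) → vertex w (fromℕ (steps w)) ≡ b
vertex-last ε       = refl
vertex-last (_ ◅ w) = vertex-last w

Simple : {a b : A} → Star R a b → Set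
Simple ε               = ⊤
Simple {a = a} (_ ◅ w) = (∀ i → a ≢ vertex w i) × Simple w

vertex-injective : {a b : A} (w : Star R a b) → Simple w → Injective _≡_ _≡_ (vertex w)
vertex-injective ε       _            {zero}  {zero}  _  = refl
vertex-injective (_ ◅ w) _            {zero}  {zero}  _  = refl
vertex-injective (_ ◅ w) (fresh , _)  {zero}  {suc j} eq = ⊥-elim (fresh j eq)
vertex-injective (_ ◅ w) (fresh , _)  {suc i} {zero}  eq = ⊥-elim (fresh i (sym eq))
vertex-injective (_ ◅ w) (_ , simple) {suc i} {suc j} eq = cong suc (vertex-injective w simple eq)

vertex-step : {a b : A} → (∀ {u w} → R u w → S u w) → (w : Star R a b) →
              ∀ i j → toℕ j ≡ suc (toℕ i) → S (vertex w i) (vertex w j)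
vertex-step r⇒s (e ◅ ε)     zero    (suc zero) refl = r⇒s e
vertex-step r⇒s (e ◅ f ◅ w) zero    (suc zero) refl = r⇒s e
vertex-step r⇒s (_ ◅ w)     (suc i) (suc j)    eq   = vertex-step r⇒s w i j (ℕ.suc-injective eq)

suffix : {a b : A} (w : Star R a b) (i : Fin (suc (steps w))) →
         ∃[ w′ ] (Simple w → Simple {R = R} {vertex w i} {b} w′)
suffix ε       zero    = ε , id
suffix (e ◅ w) zero    = e ◅ w , id
suffix (e ◅ w) (suc i) = let w′ , simple = suffix w i in w′ , simple ∘ proj₂

loop-erase : DecidableEquality A → {a b : A} → Star R a b → ∃[ w ] Simple {R = R} {a} {b} w
loop-erase _≟ᴬ_ ε = ε , tt
loop-erase _≟ᴬ_ {a} (e ◅ w) with loop-erase _≟ᴬ_ w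
... | w′ , simple with any? (λ i → a ≟ᴬ vertex w′ i)
...   | yes (i , refl) = let w″ , simple′ = suffix w′ i in w″ , simple′ simple
...   | no fresh       = e ◅ w′ , (λ i eq → fresh (i , eq)) , simple

module _ {N : ℕ} (G : Graph N) where

  Adj-sym : ∀ {u w} → Adj G u w → Adj G w u
  Adj-sym {u} {w} e = trans (adj-sym G w u) e

  Adj-irrefl : ∀ {u} → ¬ Adj G u u
  Adj-irrefl {u} e with trans (sym e) (adj-irrefl G u)
  ... | ()

  Avoiding : Fin N → Fin N → Rel (Fin N) 0ℓ
  Avoiding a b u w = Adj G u w × ¬ (u ≡ a × w ≡ b)

  acyclic⇒bridge : Acyclic G → ∀ {a b} → Adj G a b → ¬ Star (Avoiding a b) a b
  acyclic⇒bridge acyclic {a} ab w with loop-erase _≟_ w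
  ... | ε , _ = Adj-irrefl ab
  ... | (e ◅ ε) , _ = proj₂ e (refl , refl)
  -- a simple walk of at least two steps, closed up by the edge b — a, is a cycle
  ... | w′@(_ ◅ _ ◅ w″) , simple =
    acyclic (steps w″) (vertex w′)
      ((vertex-injective w′ simple , vertex-step proj₁ w′) ,
       subst (λ u → Adj G u a) (sym (vertex-last w′)) (Adj-sym ab))

module Majority {N : ℕ} (G : Graph N) where

  Adj? : ∀ x → Decidable (Adj G x)
  Adj? x y = adj G x y Bool.≟ true

  deg≡count : ∀ x → deg G x ≡ count (Adj? x)
  deg≡count x = length-filter-allFin (Adj? x)

  NbrWith : Config G → Sign → Fin N → Pred (Fin N) 0ℓ
  NbrWith ξ s x = Adj G x ∩ λ y → ξ y ≡ s

  nbrWith? : ∀ ξ s x → Decidable (NbrWith ξ s x)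
  nbrWith? ξ s x = Adj? x ∩? λ y → ξ y Sign.≟ s

  #nbrs : Config G → Sign → Fin N → ℕ
  #nbrs ξ s x = count (nbrWith? ξ s x)

  nbrSum≡⊖ : ∀ ξ x → nbrSum G ξ x ≡ #nbrs ξ plus x ⊖ #nbrs ξ minus x
  nbrSum≡⊖ ξ x = trans (go (allFin N)) (cong₂ _⊖_ (length-filter-allFin (nbrWith? ξ plus x))
                                                   (length-filter-allFin (nbrWith? ξ minus x)))
    where
    #in : Sign → List (Fin N) → ℕ
    #in s ys = length (filter (nbrWith? ξ s x) ys)
    go : ∀ ys → sumℤ G (List.map (λ y → if adj G x y then spin G (ξ y) else ℤ.+ 0) ys)
              ≡ #in plus ys ⊖ #in minus ys
    go [] = refl
    go (y ∷ ys) with adj G x y | ξ y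
    ... | false | _     = trans (+-identityˡ _) (go ys)
    ... | true  | plus  = trans (cong (ℤ._+_ ℤ.1ℤ) (go ys)) (distribʳ-⊖-+-pos 1 (#in plus ys) (#in minus ys))
    ... | true  | minus = trans (cong (ℤ._+_ ℤ.-1ℤ) (go ys)) (distribʳ-⊖-+-neg 0 (#in plus ys) (#in minus ys))

  deg≡#nbrs : ∀ ξ x → deg G x ≡ #nbrs ξ plus x + #nbrs ξ minus x
  deg≡#nbrs ξ x = trans (go (allFin N)) (cong₂ _+_ (length-filter-allFin (nbrWith? ξ plus x))
                                                   (length-filter-allFin (nbrWith? ξ minus x)))
    where
    #in : Sign → List (Fin N) → ℕ
    #in s ys = length (filter (nbrWith? ξ s x) ys)
    go : ∀ ys → length (filter (Adj? x) ys) ≡ #in plus ys + #in minus ys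
    go [] = refl
    go (y ∷ ys) with adj G x y | ξ y
    ... | false | _     = go ys
    ... | true  | plus  = cong suc (go ys)
    ... | true  | minus = trans (cong suc (go ys)) (sym (ℕ.+-suc _ _))

  sign-plus : ∀ ξ x → 2 * #nbrs ξ minus x < deg G x → sign (nbrSum G ξ x) ≡ plus
  sign-plus ξ x few rewrite nbrSum≡⊖ ξ x | deg≡#nbrs ξ x =
    cong sign (⊖-≥ (ℕ.<⇒≤ (double<+⇒< {#nbrs ξ minus x} {#nbrs ξ plus x} few)))

  sign-minus : ∀ ξ x → deg G x < 2 * #nbrs ξ minus x → sign (nbrSum G ξ x) ≡ minus
  sign-minus ξ x many rewrite nbrSum≡⊖ ξ x | deg≡#nbrs ξ x =
    sign-⊖-< (+<double⇒< {#nbrs ξ minus x} {#nbrs ξ plus x} many)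

  sign-consensus : ∀ ξ x s {S : Pred (Fin N) 0ℓ} (S? : Decidable S) →
                   (∀ {y} → Adj G x y → ¬ S y → ξ y ≡ s) →
                   2 * count (Adj? x ∩? S?) < deg G x → sign (nbrSum G ξ x) ≡ s
  sign-consensus ξ x plus {S} S? agree few =
    sign-plus ξ x (ℕ.≤-<-trans (ℕ.*-monoʳ-≤ 2 (count-mono (nbrWith? ξ minus x) (Adj? x ∩? S?) dissent)) few)
    where
    dissent : NbrWith ξ minus x ⊆ Adj G x ∩ S
    dissent {y} (e , ξy≡-) =
      e , decidable-stable (S? y) λ ¬s → Sign.s≢opposite[s] plus (trans (sym (agree e ¬s)) ξy≡-)
  sign-consensus ξ x minus {S} S? agree few =
    sign-minus ξ x (majority-bound {deg G x} {#nbrs ξ minus x} {count (Adj? x ∩? S?)} deg≤ few)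
    where
    split : Adj G x ⊆ NbrWith ξ minus x ∪ Adj G x ∩ S
    split {y} e with S? y
    ... | yes s = inj₂ (e , s)
    ... | no ¬s = inj₁ (e , agree e ¬s)
    deg≤ : deg G x ≤ #nbrs ξ minus x + count (Adj? x ∩? S?)
    deg≤ = subst (_≤ #nbrs ξ minus x + count (Adj? x ∩? S?)) (sym (deg≡count x))
                 (count-⊆-∪ (Adj? x) (nbrWith? ξ minus x) (Adj? x ∩? S?) split)

  leaf-unique : ∀ {x y z} → IsLeaf G x → Adj G x y → Adj G x z → y ≡ z
  leaf-unique {x} {y} {z} leaf e e′ = decidable-stable (y ≟ z) λ y≢z → ℕ.<-irrefl refl (begin-strict
    1                   <⟨ s≤s (count-pos (_≟ y) refl) ⟩
    suc (count (_≟ y))  ≤⟨ count-strict (Adj? x) (_≟ y) (λ { refl → e }) e′ (λ z≡y → y≢z (sym z≡y)) ⟩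
    count (Adj? x)      ≡⟨ sym (deg≡count x) ⟩
    deg G x             ≡⟨ leaf ⟩
    1                   ∎)
    where open ℕ.≤-Reasoning

  leaf-copies : ∀ ξ {x y} → IsLeaf G x → Adj G x y → sign (nbrSum G ξ x) ≡ ξ y
  leaf-copies ξ {x} {y} leaf e = sign-consensus ξ x (ξ y) ∅? (λ e′ _ → cong ξ (leaf-unique leaf e′ e))
    (subst₂ _<_ (sym (cong (2 *_) (count-zero (Adj? x ∩? ∅?) λ _ ()))) (sym leaf) (s≤s z≤n))

Consecutive : ∀ {k} → Rel (Fin k) 0ℓ
Consecutive i j = toℕ j ≡ suc (toℕ i) ⊎ toℕ i ≡ suc (toℕ j)

walk-to-zero : ∀ {k} (i : Fin (suc k)) → Star Consecutive i zero
walk-to-zero zero = ε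
walk-to-zero {suc k} (suc i) =
  gmap suc (Sum.map (cong suc) (cong suc)) (walk-to-zero i) ◅◅ inj₂ refl ◅ ε

walk-on-line : ∀ {k} (i j : Fin k) → Star Consecutive i j
walk-on-line {suc k} i j = walk-to-zero i ◅◅ reverse swap (walk-to-zero j)

consecutive⇒≤ : ∀ {k} {i j : Fin k} → Consecutive i j → toℕ i ≤ suc (toℕ j)
consecutive⇒≤ {i = i} (inj₁ j≡) =
  subst (toℕ i ≤_) (cong suc (sym j≡)) (ℕ.m≤n⇒m≤1+n (ℕ.n≤1+n (toℕ i)))
consecutive⇒≤ (inj₂ i≡) = ℕ.≤-reflexive i≡

module PathInTree {N : ℕ} (T : Graph N) (tree : IsTree T)
                  {n : ℕ} (v : Fin (suc n) → Fin N) (path : IsPath T v) where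

  OnPath : Pred (Fin N) 0ℓ
  OnPath x = ∃[ m ] v m ≡ x

  onPath? : Decidable OnPath
  onPath? x = any? (λ m → v m ≟ x)

  path-adj : ∀ {i j} → Consecutive i j → Adj T (v i) (v j)
  path-adj {i} {j} (inj₁ e) = proj₂ path i j e
  path-adj {i} {j} (inj₂ e) = Adj-sym T (proj₂ path j i e)

  no-chord : ∀ {i j} → Adj T (v i) (v j) → Consecutive i j
  no-chord {i} {j} e with (toℕ j ℕ.≟ suc (toℕ i)) ⊎-dec (toℕ i ℕ.≟ suc (toℕ j))
  ... | yes c = c
  ... | no ¬c = ⊥-elim (acyclic⇒bridge T (proj₂ tree) e (gmap v along (walk-on-line i j)))
    where
    along : ∀ {a b} → Consecutive a b → Avoiding T (v i) (v j) (v a) (v b)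
    along c = path-adj c , λ (a≡ , b≡) → ¬c (subst₂ Consecutive (proj₁ path a≡) (proj₁ path b≡) c)

  OffEdge : Rel (Fin N) 0ℓ
  OffEdge u w = Adj T u w × ¬ OnPath u × ¬ OnPath w

  OffEdge-sym : ∀ {u w} → OffEdge u w → OffEdge w u
  OffEdge-sym (e , off-u , off-w) = Adj-sym T e , off-w , off-u

  Exit : Fin N → Fin N → Fin (suc n) → Set
  Exit x r m = Star OffEdge x r × ¬ OnPath r × Adj T r (v m)

  exit-unique : ∀ {r r′ m m′} → Star OffEdge r r′ → ¬ OnPath r → Adj T r (v m) → Adj T r′ (v m′) →
                r ≡ r′ × m ≡ m′
  exit-unique {r} {r′} {m} {m′} route off-r e e′ with (r ≟ r′) ×-dec (m ≟ m′)
  ... | yes same = same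
  ... | no ¬same = ⊥-elim (acyclic⇒bridge T (proj₂ tree) (Adj-sym T e) walk)
    where
    along : ∀ {a b} → Consecutive a b → Avoiding T (v m) r (v a) (v b)
    along {b = b} c = path-adj c , λ (_ , vb≡r) → off-r (b , vb≡r)
    off : ∀ {u w} → OffEdge u w → Avoiding T (v m) r u w
    off (e , off-u , _) = e , λ (u≡vm , _) → off-u (m , sym u≡vm)
    walk : Star (Avoiding T (v m) r) (v m) r
    walk = gmap v along (walk-on-line m m′)
       ◅◅ (Adj-sym T e′ , λ (vm′≡vm , r′≡r) → ¬same (sym r′≡r , sym (proj₁ path vm′≡vm)))
       ◅ map off (reverse OffEdge-sym route)

  first-exit : ∀ {x y} → Walk T x y → Fin N × Fin (suc n)
  first-exit (here x) = x , zero  -- junk: the walk starts on the path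
  first-exit (step {u = x} {v = y} _ w) with onPath? y
  ... | yes (m , _) = x , m
  ... | no _        = first-exit w

  first-exit-spec : ∀ {x y} (w : Walk T x y) → ¬ OnPath x → OnPath y →
                    Exit x (proj₁ (first-exit w)) (proj₂ (first-exit w))
  first-exit-spec (here x) off-x on-y = ⊥-elim (off-x on-y)
  first-exit-spec (step {u = x} {v = y} e w) off-x on-y with onPath? y
  ... | yes (m , refl) = ε , off-x , e
  ... | no off-y       = let route , off-r , e′ = first-exit-spec w off-y on-y
                         in (e , off-x , off-y) ◅ route , off-r , e′

  to-start : ∀ x → Walk T x (v zero)
  to-start x = proj₁ tree x (v zero)

  root : Fin N → Fin N
  root x = proj₁ (first-exit (to-start x))

  attach : Fin N → Fin (suc n)
  attach x = proj₂ (first-exit (to-start x))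

  exit : ∀ {x} → ¬ OnPath x → Exit x (root x) (attach x)
  exit {x} off-x = first-exit-spec (to-start x) off-x (zero , refl)

  exit-of-adjacent : ∀ {x m} → ¬ OnPath x → Adj T x (v m) → root x ≡ x × attach x ≡ m
  exit-of-adjacent off-x e = let route , off-r , e′ = exit off-x in
    exit-unique (reverse OffEdge-sym route) off-r e′ e

  exit-of-neighbour : ∀ {x y} → ¬ OnPath x → ¬ OnPath y → Adj T x y →
                      root x ≡ root y × attach x ≡ attach y
  exit-of-neighbour off-x off-y e = let route , off-r , e′ = exit off-x ; route′ , _ , e″ = exit off-y in
    exit-unique (reverse OffEdge-sym route ◅◅ (e , off-x , off-y) ◅ route′) off-r e′ e″

module Construction {N : ℕ} (T : Graph N) (tree : IsTree T) (odd : ∀ x → Odd (deg T x))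
  {n : ℕ} (v : Fin (suc n) → Fin N) (path : IsPath T v)
  (last-leaves  : ∀ k → suc (toℕ k) ≡ suc n → 2 * leafNbrs T (v k) ≤ deg T (v k) ∸ 1)
  (inner-leaves : ∀ k → suc (toℕ k) < suc n → 2 * leafNbrs T (v k) < deg T (v k) ∸ 1) where

  open PathInTree T tree v path
  open Majority T

  half : Fin (suc n) → ℕ
  half k = proj₁ (odd (v k))

  deg-path : ∀ k → deg T (v k) ≡ suc (2 * half k)
  deg-path k = proj₂ (odd (v k))

  leaf? : Decidable (IsLeaf T)
  leaf? x = deg T x ℕ.≟ 1

  Heavy : Fin (suc n) → Pred (Fin N) 0ℓ
  Heavy k = Adj T (v k) ∩ ∁ OnPath ∩ ∁ (IsLeaf T)

  heavy? : ∀ k → Decidable (Heavy k)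
  heavy? k = Adj? (v k) ∩? ∁? onPath? ∩? ∁? leaf?

  LeafNbr : Fin (suc n) → Pred (Fin N) 0ℓ
  LeafNbr k = IsLeaf T ∩ Adj T (v k)

  leafNbr? : ∀ k → Decidable (LeafNbr k)
  leafNbr? k = leaf? ∩? Adj? (v k)

  Prev Next : Fin (suc n) → Pred (Fin N) 0ℓ
  Prev k y = ∃[ m ] (toℕ k ≡ suc (toℕ m) × v m ≡ y)
  Next k y = ∃[ m ] (toℕ m ≡ suc (toℕ k) × v m ≡ y)

  prev? : ∀ k → Decidable (Prev k)
  prev? k y = any? λ m → (toℕ k ℕ.≟ suc (toℕ m)) ×-dec (v m ≟ y)

  next? : ∀ k → Decidable (Next k)
  next? k y = any? λ m → (toℕ m ℕ.≟ suc (toℕ k)) ×-dec (v m ≟ y)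

  classify : ∀ {k y} → Adj T (v k) y → (Heavy k y ⊎ Prev k y) ⊎ (LeafNbr k y ⊎ Next k y)
  classify {k} {y} e with onPath? y
  ... | yes (m , refl) with no-chord e
  ...   | inj₁ next = inj₂ (inj₂ (m , next , refl))
  ...   | inj₂ prev = inj₁ (inj₂ (m , prev , refl))
  classify {k} {y} e | no off with leaf? y
  ...   | yes leaf = inj₂ (inj₁ (leaf , e))
  ...   | no ¬leaf = inj₁ (inj₁ (e , off , ¬leaf))

  count-prev≤1 : ∀ k → count (prev? k) ≤ 1
  count-prev≤1 k = count≤1 (prev? k) λ { (m , k≡ , refl) (m′ , k≡′ , refl) →
    cong v (toℕ-injective (ℕ.suc-injective (trans (sym k≡) k≡′))) }

  count-next≤1 : ∀ k → count (next? k) ≤ 1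
  count-next≤1 k = count≤1 (next? k) λ { (m , m≡ , refl) (m′ , m≡′ , refl) →
    cong v (toℕ-injective (trans m≡ (sym m≡′))) }

  count-prev-first : count (prev? zero) ≡ 0
  count-prev-first = count-zero (prev? zero) λ { _ (_ , () , _) }

  count-next-last : ∀ k → suc (toℕ k) ≡ suc n → count (next? k) ≡ 0
  count-next-last k last = count-zero (next? k) λ { _ (m , m≡ , _) →
    ℕ.<-irrefl (trans m≡ last) (toℕ<n m) }

  leafNbrs≡count : ∀ k → leafNbrs T (v k) ≡ count (leafNbr? k)
  leafNbrs≡count k =
    trans (cong length (filter-filter (Adj? (v k)) leaf? (allFin N))) (length-filter-allFin (leafNbr? k))

  leaves+next≤half : ∀ k → count (leafNbr? k) + count (next? k) ≤ half k
  leaves+next≤half k with ℕ.m≤n⇒m<n∨m≡n (toℕ<n k)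
  ... | inj₁ inner = ℕ.≤-trans (ℕ.+-monoʳ-≤ (count (leafNbr? k)) (count-next≤1 k))
                               (subst (_≤ half k) (ℕ.+-comm 1 (count (leafNbr? k))) leaves<half)
    where leaves<half : count (leafNbr? k) < half k
          leaves<half = ℕ.*-cancelˡ-< 2 _ _
            (subst₂ (λ l d → 2 * l < d ∸ 1) (leafNbrs≡count k) (deg-path k) (inner-leaves k inner))
  ... | inj₂ last  = subst (_≤ half k) (sym (trans (cong (count (leafNbr? k) +_) (count-next-last k last))
                                                   (ℕ.+-identityʳ _)))
                       (ℕ.*-cancelˡ-≤ 2
                         (subst₂ (λ l d → 2 * l ≤ d ∸ 1) (leafNbrs≡count k) (deg-path k) (last-leaves k last)))

  heavy+prev>half : ∀ k → suc (half k) ≤ count (heavy? k) + count (prev? k)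
  heavy+prev>half k = odd-split (begin
    suc (2 * half k)
      ≡⟨ sym (deg-path k) ⟩
    deg T (v k)
      ≡⟨ deg≡count (v k) ⟩
    count (Adj? (v k))
      ≤⟨ count-⊆-∪ (Adj? (v k)) (heavy? k ∪? prev? k) (leafNbr? k ∪? next? k) classify ⟩
    count (heavy? k ∪? prev? k) + count (leafNbr? k ∪? next? k)
      ≤⟨ ℕ.+-mono-≤ (count-∪ (heavy? k) (prev? k)) (count-∪ (leafNbr? k) (next? k)) ⟩
    (count (heavy? k) + count (prev? k)) + (count (leafNbr? k) + count (next? k))
      ≤⟨ ℕ.+-monoʳ-≤ (count (heavy? k) + count (prev? k)) (leaves+next≤half k) ⟩
    (count (heavy? k) + count (prev? k)) + half k
      ∎)
    where open ℕ.≤-Reasoning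

  heavy-first : suc (half zero) ≤ count (heavy? zero)
  heavy-first = subst (suc (half zero) ≤_)
                      (trans (cong (count (heavy? zero) +_) count-prev-first) (ℕ.+-identityʳ _))
                      (heavy+prev>half zero)

  heavy-later : ∀ j → half (suc j) ≤ count (heavy? (suc j))
  heavy-later j = s≤s⁻¹ (ℕ.≤-trans (heavy+prev>half (suc j))
                          (ℕ.≤-trans (ℕ.+-monoʳ-≤ (count (heavy? (suc j))) (count-prev≤1 (suc j)))
                                     (ℕ.≤-reflexive (ℕ.+-comm (count (heavy? (suc j))) 1))))


  chosen-spec : ∀ j → ∃[ s ] ((∀ {y} → y ∈ s → Heavy (suc j) y) × count (_∈? s) ≡ half (suc j))
  chosen-spec j = subset-of-size (heavy? (suc j)) (half (suc j)) (heavy-later j)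

  chosen : Fin n → Subset N
  chosen j = proj₁ (chosen-spec j)

  chosen-heavy : ∀ j {y} → y ∈ chosen j → Heavy (suc j) y
  chosen-heavy j = proj₁ (proj₂ (chosen-spec j))

  count-chosen : ∀ j → count (_∈? chosen j) ≡ half (suc j)
  count-chosen j = proj₂ (proj₂ (chosen-spec j))

  chosen-spin : Fin n → Fin N → Sign
  chosen-spin j r = if does (r ∈? chosen j) then minus else plus

  chosen-spin-∈ : ∀ {j r} → r ∈ chosen j → chosen-spin j r ≡ minus
  chosen-spin-∈ {j} {r} r∈ rewrite dec-true (r ∈? chosen j) r∈ = refl

  chosen-spin-∉ : ∀ {j r} → r ∉ chosen j → chosen-spin j r ≡ plus
  chosen-spin-∉ {j} {r} r∉ rewrite dec-false (r ∈? chosen j) r∉ = refl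

  branch-spin : Fin (suc n) → Fin N → Fin N → Sign
  branch-spin zero    r x = if does (x ≟ r) then plus else minus
  branch-spin (suc j) r _ = chosen-spin j r

  ξ₀ : Config T
  ξ₀ x = if does (onPath? x) then plus else branch-spin (attach x) (root x) x

  ξ : ℕ → Config T
  ξ = dyn T ξ₀

  ξ₀-on-path : ∀ {x} → OnPath x → ξ₀ x ≡ plus
  ξ₀-on-path {x} on rewrite dec-true (onPath? x) on = refl

  ξ₀-first-root : ∀ {x} → ¬ OnPath x → attach x ≡ zero → root x ≡ x → ξ₀ x ≡ plus
  ξ₀-first-root {x} off at≡ root≡
    rewrite dec-false (onPath? x) off | at≡ | root≡ | dec-true (x ≟ x) refl = refl

  ξ₀-first-deep : ∀ {x} → ¬ OnPath x → attach x ≡ zero → x ≢ root x → ξ₀ x ≡ minus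
  ξ₀-first-deep {x} off at≡ x≢root
    rewrite dec-false (onPath? x) off | at≡ | dec-false (x ≟ root x) x≢root = refl

  ξ₀-later : ∀ {x j} → ¬ OnPath x → attach x ≡ suc j → ξ₀ x ≡ chosen-spin j (root x)
  ξ₀-later {x} off at≡ rewrite dec-false (onPath? x) off | at≡ = refl

  ξ₀-first-nbr : ∀ {y} → Adj T (v zero) y → ξ₀ y ≡ plus
  ξ₀-first-nbr {y} e with onPath? y
  ... | yes on = ξ₀-on-path on
  ... | no off = let root≡ , at≡ = exit-of-adjacent off (Adj-sym T e) in ξ₀-first-root off at≡ root≡

  ξ₀-later-nbr : ∀ {j y} → Adj T (v (suc j)) y → ¬ OnPath y → ξ₀ y ≡ chosen-spin j y
  ξ₀-later-nbr {j} e off = let root≡ , at≡ = exit-of-adjacent off (Adj-sym T e) in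
    trans (ξ₀-later off at≡) (cong (chosen-spin j) root≡)

  few-path-nbrs : ∀ {x} → ¬ OnPath x → ¬ IsLeaf T (root x) → 2 * count (Adj? x ∩? onPath?) < deg T x
  few-path-nbrs {x} off ¬leaf with any? (λ m → Adj? x (v m))
  ... | no none = subst (λ c → 2 * c < deg T x)
                        (sym (count-zero (Adj? x ∩? onPath?) λ { _ (e , m , refl) → none (m , e) }))
                        (odd⇒pos (odd x))
  ... | yes (m , e) = ℕ.≤-<-trans (ℕ.*-monoʳ-≤ 2 at-most-one)
                        (odd⇒≥3 (odd x) (subst (¬_ ∘ IsLeaf T) (proj₁ (exit-of-adjacent off e)) ¬leaf))
    where at-most-one : count (Adj? x ∩? onPath?) ≤ 1
          at-most-one = count≤1 (Adj? x ∩? onPath?) λ { (e , m , refl) (e′ , m′ , refl) →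
            cong v (trans (sym (proj₂ (exit-of-adjacent off e))) (proj₂ (exit-of-adjacent off e′))) }

  heavy-first-flips : ∀ {w} → Heavy zero w → ξ 1 w ≡ minus
  heavy-first-flips {w} (e , off , ¬leaf) =
    sign-consensus ξ₀ w minus onPath? deeper (few-path-nbrs off (subst (¬_ ∘ IsLeaf T) (sym root≡) ¬leaf))
    where
    root≡ : root w ≡ w
    root≡ = proj₁ (exit-of-adjacent off (Adj-sym T e))
    at≡ : attach w ≡ zero
    at≡ = proj₂ (exit-of-adjacent off (Adj-sym T e))
    deeper : ∀ {y} → Adj T w y → ¬ OnPath y → ξ₀ y ≡ minus
    deeper {y} e′ off-y = let same-root , same-at = exit-of-neighbour off off-y e′ in
      ξ₀-first-deep off-y (trans (sym same-at) at≡)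
                          (λ y≡ → Adj-irrefl T (subst (Adj T w) (trans y≡ (trans (sym same-root) root≡)) e′))

  branch-frozen : ∀ t {x j} → ¬ OnPath x → attach x ≡ suc j → ¬ IsLeaf T (root x) →
                  ξ t x ≡ chosen-spin j (root x)
  branch-frozen zero    off at≡ _ = ξ₀-later off at≡
  branch-frozen (suc t) {x} {j} off at≡ ¬leaf =
    sign-consensus (ξ t) x (chosen-spin j (root x)) onPath? same (few-path-nbrs off ¬leaf)
    where
    same : ∀ {y} → Adj T x y → ¬ OnPath y → ξ t y ≡ chosen-spin j (root x)
    same e off-y = let same-root , same-at = exit-of-neighbour off off-y e in
      trans (branch-frozen t off-y (trans (sym same-at) at≡) (subst (¬_ ∘ IsLeaf T) same-root ¬leaf))
            (cong (chosen-spin j) (sym same-root))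

  heavy-frozen : ∀ t {j y} → Heavy (suc j) y → ξ t y ≡ chosen-spin j y
  heavy-frozen t {j} (e , off , ¬leaf) = let root≡ , at≡ = exit-of-adjacent off (Adj-sym T e) in
    trans (branch-frozen t off at≡ (subst (¬_ ∘ IsLeaf T) (sym root≡) ¬leaf))
          (cong (chosen-spin j) root≡)

  stays-plus : ∀ t k {S : Pred (Fin N) 0ℓ} (S? : Decidable S) →
               (∀ {y} → Adj T (v k) y → ¬ S y → ξ t y ≡ plus) →
               count (Adj? (v k) ∩? S?) ≤ half k → ξ (suc t) (v k) ≡ plus
  stays-plus t k S? agree few = sign-consensus (ξ t) (v k) plus S? agree
    (subst (2 * count (Adj? (v k) ∩? S?) <_) (sym (deg-path k)) (s≤s (ℕ.*-monoʳ-≤ 2 few)))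

  flips : ∀ t k → suc (half k) ≤ #nbrs (ξ t) minus (v k) → ξ (suc t) (v k) ≡ minus
  flips t k many =
    sign-minus (ξ t) (v k) (subst (_< 2 * #nbrs (ξ t) minus (v k)) (sym (deg-path k)) (odd<double many))

  chosen-nbrs≤half : ∀ j → count (Adj? (v (suc j)) ∩? (_∈? chosen j)) ≤ half (suc j)
  chosen-nbrs≤half j = subst (count (Adj? (v (suc j)) ∩? (_∈? chosen j)) ≤_) (count-chosen j)
                             (count-mono (Adj? (v (suc j)) ∩? (_∈? chosen j)) (_∈? chosen j) proj₂)

  path-plus : ∀ t k → t ≤ suc (toℕ k) → ξ t (v k) ≡ plus
  leaf-plus : ∀ t k {x} → IsLeaf T x → Adj T (v k) x → t ≤ suc (toℕ k) → ξ t x ≡ plus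

  path-plus zero    k       _          = ξ₀-on-path (k , refl)
  path-plus (suc t) zero    (s≤s z≤n) = stays-plus 0 zero ∅? (λ e _ → ξ₀-first-nbr e)
    (subst (_≤ half zero) (sym (count-zero (Adj? (v zero) ∩? ∅?) λ _ ())) z≤n)
  path-plus (suc t) (suc j) (s≤s t≤) = stays-plus t (suc j) (_∈? chosen j) unchosen-plus (chosen-nbrs≤half j)
    where
    unchosen-plus : ∀ {y} → Adj T (v (suc j)) y → y ∉ chosen j → ξ t y ≡ plus
    unchosen-plus {y} e y∉ with onPath? y
    ... | yes (m , refl) = path-plus t m (ℕ.≤-trans t≤ (consecutive⇒≤ (no-chord e)))
    ... | no off with leaf? y
    ...   | yes leaf = leaf-plus t (suc j) leaf e (ℕ.m≤n⇒m≤1+n t≤)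
    ...   | no ¬leaf = trans (heavy-frozen t (e , off , ¬leaf)) (chosen-spin-∉ y∉)

  leaf-plus zero    zero    leaf e _ = ξ₀-first-nbr e
  leaf-plus zero    (suc j) {x} leaf e _ with onPath? x
  ... | yes on = ξ₀-on-path on
  ... | no off = trans (ξ₀-later-nbr e off) (chosen-spin-∉ λ x∈ → proj₂ (proj₂ (chosen-heavy j x∈)) leaf)
  leaf-plus (suc t) k leaf e (s≤s t≤) =
    trans (leaf-copies (ξ t) leaf (Adj-sym T e)) (path-plus t k (ℕ.m≤n⇒m≤1+n t≤))

  path-minus : ∀ m k → toℕ k ≡ m → ξ (2 + m) (v k) ≡ minus
  path-minus zero    zero    _  = flips 1 zero (ℕ.≤-trans heavy-first
    (count-mono (heavy? zero) (nbrWith? (ξ 1) minus (v zero)) λ { h@(e , _) → e , heavy-first-flips h }))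
  path-minus (suc m) (suc j) k≡ = flips (2 + m) (suc j)
    (subst (_≤ #nbrs (ξ (2 + m)) minus (v (suc j))) (cong suc (count-chosen j))
           (count-strict (nbrWith? (ξ (2 + m)) minus (v (suc j))) (_∈? chosen j)
                         chosen-minus prev-minus prev-unchosen))
    where
    prev = inject₁ j
    chosen-minus : ∀ {y} → y ∈ chosen j → NbrWith (ξ (2 + m)) minus (v (suc j)) y
    chosen-minus y∈ = proj₁ (chosen-heavy j y∈) ,
                      trans (heavy-frozen (2 + m) (chosen-heavy j y∈)) (chosen-spin-∈ y∈)
    prev-minus : NbrWith (ξ (2 + m)) minus (v (suc j)) (v prev)
    prev-minus = path-adj (inj₂ (cong suc (sym (toℕ-inject₁ j)))) ,
                 path-minus m prev (trans (toℕ-inject₁ j) (ℕ.suc-injective k≡))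
    prev-unchosen : v prev ∉ chosen j
    prev-unchosen prev∈ = proj₁ (proj₂ (chosen-heavy j prev∈)) (prev , refl)

claim4 : (N : ℕ) (T : Graph N) → IsTree T → (∀ v → Odd (deg T v))
    → (n : ℕ) (v : Fin n → Fin N) → IsPath T v
    → (∀ (k : Fin n) → suc (toℕ k) ≡ n → 2 * leafNbrs T (v k) ≤ deg T (v k) ∸ 1)
    → (∀ (k : Fin n) → suc (toℕ k) < n → 2 * leafNbrs T (v k) < deg T (v k) ∸ 1)
    → Σ (Config T) λ ξ₀ →
        (∀ (k : Fin n) → dyn T ξ₀ (suc (suc (toℕ k))) (v k) ≡ minus)
        × (∀ (k : Fin n) (t : ℕ) → t ≤ suc (toℕ k) → dyn T ξ₀ t (v k) ≡ plus)
claim4 N T tree odd zero    v path last-leaves inner-leaves = (λ _ → plus) , (λ ()) , (λ ())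
claim4 N T tree odd (suc n) v path last-leaves inner-leaves =
  ξ₀ , (λ k → path-minus (toℕ k) k refl) , (λ k t t≤ → path-plus t k t≤)
  where open Construction T tree odd v path last-leaves inner-leaves
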